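{- Let $q$ be an odd prime power and let $n\ge 2$ be odd. If $V\subseteq\mathbb{F}_{q^n}$ is an $\mathbb{F}_q$-vector subspace, then there are exactly $\#V$ elements $y\in\mathbb{F}_{q^n}$ such that $y^2\in V$. -}

module Defs where

open import Level using (Level; _⊔_; suc)
open import Algebra.Bundles using (CommutativeRing)
open import Data.Nat using (ℕ) renaming (suc to sucℕ; _^_ to _^ℕ_)
open import Data.Nat.Primality using (Prime)
open import Data.Fin using (Fin)
open import Data.List using (length; filter; allFin)
open import Data.Product using (Σ; ∃; _×_)
open import Relation.Nullary using (¬_; Dec)
open import Relation.Binary.PropositionalEquality using (_≡_)

IsPrimePower : ℕ → Set
IsPrimePower q = Σ ℕ λ p → Σ ℕ λ k → Prime p × q ≡ p ^ℕ sucℕ k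

module _ {c ℓ : Level} (K : CommutativeRing c ℓ) where
  open CommutativeRing K

  IsField : Set (c ⊔ ℓ)
  IsField = (¬ (1# ≈ 0#)) × (∀ x → ¬ (x ≈ 0#) → ∃ λ y → x * y ≈ 1#)

  record Enumeration (N : ℕ) : Set (c ⊔ ℓ) where
    field
      enum      : Fin N → Carrier
      enum-inj  : ∀ i j → enum i ≈ enum j → i ≡ j
      enum-surj : ∀ x → ∃ λ i → enum i ≈ x

  count : ∀ {N p} → Enumeration N → {P : Carrier → Set p} → (∀ x → Dec (P x)) → ℕ
  count {N} E P? = length (filter (λ i → P? (Enumeration.enum E i)) (allFin N))

  record Subfield (p : Level) : Set (c ⊔ ℓ ⊔ suc p) where
    field
      mem      : Carrier → Set p
      dec      : ∀ x → Dec (mem x)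
      resp     : ∀ {x y} → x ≈ y → mem x → mem y
      zero-mem : mem 0#
      one-mem  : mem 1#
      +-mem    : ∀ {x y} → mem x → mem y → mem (x + y)
      neg-mem  : ∀ {x} → mem x → mem (- x)
      *-mem    : ∀ {x y} → mem x → mem y → mem (x * y)
      inv-mem  : ∀ {x y} → mem x → x * y ≈ 1# → mem y

  record Subspace {p} (S : Subfield p) (r : Level) : Set (c ⊔ ℓ ⊔ p ⊔ suc r) where
    field
      mem      : Carrier → Set r
      dec      : ∀ x → Dec (mem x)
      resp     : ∀ {x y} → x ≈ y → mem x → mem y
      zero-mem : mem 0#
      +-mem    : ∀ {x y} → mem x → mem y → mem (x + y)
      smul-mem : ∀ {s v} → Subfield.mem S s → mem v → mem (s * v)

-- Write r(x) for the number of square roots of x in K, so that #{y | y² ∈ V} = Σ_{x ∈ V} r(x).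
-- Since qⁿ is odd, K does not have characteristic 2 (else the pairs {x, x + 1} would partition K),
-- so a nonzero square has exactly two roots. The subfield F contains a non-square c of K: otherwise
-- the y with y² ∈ F ∖ {0} form a subgroup of K* of order 2(q − 1), and Lagrange's theorem would
-- make 2(q − 1) divide qⁿ − 1, i.e. make the repunit 1 + q + ⋯ + qⁿ⁻¹ even, which fails for q, n odd.
-- Multiplication by c sends nonzero squares to non-squares, whence r(x) + r(cx) = 2 for every x,
-- and as cV = V, summing over V gives 2 · #{y | y² ∈ V} = Σ_{x ∈ V} (r(x) + r(cx)) = 2 · #V.

{-# OPTIONS --safe #-}
module Submission where

open import Defs
open import Level using (Level; _⊔_)
open import Algebra.Bundles using (CommutativeRing)
open import Data.Nat using (ℕ; _^_; _≤_)
open import Data.Nat.Divisibility using (_∣_)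
open import Relation.Nullary using (¬_)
open import Relation.Binary.PropositionalEquality using (_≡_)

open import Function using (_∘_; _on_; id)
open import Data.Bool using (if_then_else_)
open import Data.Empty using (⊥-elim)
open import Data.Product using (∃; _×_; _,_; proj₁; proj₂)
open import Data.Sum using (_⊎_; inj₁; inj₂)
open import Data.Nat using (zero; suc; _∸_; _<_; z≤n; s≤s; NonTrivial; nonTrivial⇒n>1; nonTrivial⇒nonZero)
import Data.Nat as ℕ
import Data.Nat.Properties as ℕₚ
open import Data.Nat.Divisibility
  using (divides; ∣m∣n⇒∣m+n; ∣m+n∣m⇒∣n; ∣m⇒∣m*n; *-cancelˡ-∣; ∣1⇒≡1)
open import Data.Nat.Tactic.RingSolver using (solve-∀)
open import Data.Nat.Primality using (prime⇒nonTrivial)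
open import Data.Fin as Fin using (Fin; zero; suc)
import Data.Fin.Properties as Fin
open import Data.Vec.Functional using (Vector)
open import Data.List using (length; filter; tabulate)
open import Relation.Nullary using (Dec; does; yes; no; ¬?)
open import Relation.Nullary.Decidable using (_×-dec_; _⊎-dec_; _→-dec_; map′)
open import Relation.Unary using (Pred; Decidable)
open import Relation.Binary using (Rel; IsPartialEquivalence; _Respects_; _Preserves_⟶_)
  renaming (Decidable to Decidable₂)
import Relation.Binary.PropositionalEquality as ≡
import Relation.Binary.Reasoning.Setoid as SetoidReasoning
open import Algebra.Properties.Semiring.Sum ℕₚ.+-*-semiring
  using (sum; ∑-comm; ∑-distrib-+; *-distribˡ-sum; *-distribʳ-sum; sum-cong-≗; sum-replicate-zero)

-- ℕ arithmetic is opened only in this block, so that _+_, _*_, refl, … below refer to the ring.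
module _ where
  open import Data.Nat using (_+_; _*_)
  open import Data.Nat.Properties hiding (_≟_)
  open ≡ using (refl; sym; trans; cong; cong₂; subst; module ≡-Reasoning)

  𝟙 : ∀ {a} {A : Set a} → Dec A → ℕ
  𝟙 a? = if does a? then 1 else 0

  module _ {a} {A : Set a} where

    𝟙-yes : (a? : Dec A) → A → 𝟙 a? ≡ 1
    𝟙-yes (yes _) _ = refl
    𝟙-yes (no ¬a) a = ⊥-elim (¬a a)

    𝟙-no : (a? : Dec A) → ¬ A → 𝟙 a? ≡ 0
    𝟙-no (yes a) ¬a = ⊥-elim (¬a a)
    𝟙-no (no _)  _  = refl

    𝟙-¬ : (a? : Dec A) → 𝟙 (¬? a?) + 𝟙 a? ≡ 1
    𝟙-¬ (yes _) = refl
    𝟙-¬ (no _)  = refl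

    𝟙*-cong : (a? : Dec A) {m n : ℕ} → (A → m ≡ n) → 𝟙 a? * m ≡ 𝟙 a? * n
    𝟙*-cong (yes a) m≡n = cong (1 *_) (m≡n a)
    𝟙*-cong (no _)  _   = refl

  module _ {a b} {A : Set a} {B : Set b} where

    𝟙-cong : (A → B) → (B → A) → (a? : Dec A) (b? : Dec B) → 𝟙 a? ≡ 𝟙 b?
    𝟙-cong A→B B→A (yes a) b? = sym (𝟙-yes b? (A→B a))
    𝟙-cong A→B B→A (no ¬a) b? = sym (𝟙-no b? (¬a ∘ B→A))

    𝟙-× : (a? : Dec A) (b? : Dec B) → 𝟙 (a? ×-dec b?) ≡ 𝟙 a? * 𝟙 b?
    𝟙-× (yes _) b? = sym (+-identityʳ (𝟙 b?))
    𝟙-× (no _)  b? = refl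

    𝟙-⊎ : ¬ (A × B) → (a? : Dec A) (b? : Dec B) → 𝟙 (a? ⊎-dec b?) ≡ 𝟙 a? + 𝟙 b?
    𝟙-⊎ ¬a×b (yes a) b? = cong suc (sym (𝟙-no b? (λ b → ¬a×b (a , b))))
    𝟙-⊎ ¬a×b (no _)  b? = refl

  sum-1 : ∀ n → sum {n} (λ _ → 1) ≡ n
  sum-1 zero    = refl
  sum-1 (suc n) = cong suc (sum-1 n)

  sum-δ : ∀ {n} (i : Fin n) (f : Vector ℕ n) → sum (λ j → 𝟙 (i Fin.≟ j) * f j) ≡ f i
  sum-δ {suc n} zero    f = trans (cong₂ _+_ (*-identityˡ (f zero)) (sum-replicate-zero n)) (+-identityʳ (f zero))
  sum-δ         (suc i) f = sum-δ i (f ∘ suc)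

  sum-unique : ∀ {n p} {P : Pred (Fin n) p} (P? : Decidable P) {i} → P i → (∀ {j} → P j → j ≡ i) →
               sum (𝟙 ∘ P?) ≡ 1
  sum-unique P? {i} pᵢ unique = begin
    sum (𝟙 ∘ P?)                   ≡⟨ sum-cong-≗ (λ j → 𝟙-cong (sym ∘ unique) (λ { refl → pᵢ }) (P? j) (i Fin.≟ j)) ⟩
    sum (λ j → 𝟙 (i Fin.≟ j))      ≡⟨ sum-cong-≗ (λ j → *-identityʳ (𝟙 (i Fin.≟ j))) ⟨
    sum (λ j → 𝟙 (i Fin.≟ j) * 1)  ≡⟨ sum-δ i (λ _ → 1) ⟩
    1                              ∎
    where open ≡-Reasoning

  sum-mono-≤ : ∀ {n} {f g : Vector ℕ n} → (∀ i → f i ≤ g i) → sum f ≤ sum g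
  sum-mono-≤ {zero}  f≤g = z≤n
  sum-mono-≤ {suc n} f≤g = +-mono-≤ (f≤g zero) (sum-mono-≤ (f≤g ∘ suc))

  sum-≤-≡ : ∀ {n} {f g : Vector ℕ n} → (∀ i → f i ≤ g i) → sum f ≡ sum g → ∀ i → f i ≡ g i
  sum-≤-≡ {suc n} {f} {g} f≤g Σf≡Σg zero =
    ≤-antisym (f≤g zero) (+-cancelʳ-≤ (sum (f ∘ suc)) (g zero) (f zero) (begin
      g zero + sum (f ∘ suc)  ≤⟨ +-monoʳ-≤ (g zero) (sum-mono-≤ (f≤g ∘ suc)) ⟩
      g zero + sum (g ∘ suc)  ≡⟨ Σf≡Σg ⟨
      f zero + sum (f ∘ suc)  ∎))
    where open ≤-Reasoning
  sum-≤-≡ {suc n} {f} {g} f≤g Σf≡Σg (suc i) =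
    sum-≤-≡ (f≤g ∘ suc) (+-cancelˡ-≡ (f zero) _ _ (trans Σf≡Σg (cong (_+ _) (sym head≡)))) i
    where
    head≡ : f zero ≡ g zero
    head≡ = sum-≤-≡ f≤g Σf≡Σg zero

  length-filter-tabulate : ∀ {a p} {A : Set a} {P : Pred A p} (P? : Decidable P) {n} (f : Fin n → A) →
                           length (filter P? (tabulate f)) ≡ sum (𝟙 ∘ P? ∘ f)
  length-filter-tabulate P? {zero}  f = refl
  length-filter-tabulate P? {suc n} f with P? (f zero)
  ... | yes _ = cong suc (length-filter-tabulate P? (f ∘ suc))
  ... | no  _ = length-filter-tabulate P? (f ∘ suc)

  least : ∀ {n p} {P : Pred (Fin n) p} → Decidable P → ∃ P → ∃ λ i → P i × ∀ {j} → P j → i Fin.≤ j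
  least {suc n} P? _ with P? zero
  ... | yes p₀ = zero , p₀ , λ _ → z≤n
  least {suc n} P? (zero  , p₀) | no ¬p₀ = ⊥-elim (¬p₀ p₀)
  least {suc n} P? (suc i , pᵢ) | no ¬p₀ with least (P? ∘ suc) (i , pᵢ)
  ... | k , pₖ , k-least = suc k , pₖ , λ { {zero} p₀ → ⊥-elim (¬p₀ p₀) ; {suc j} pⱼ → s≤s (k-least pⱼ) }

  module PartialEquivalence {n r} {_~_ : Rel (Fin n) r} (_~?_ : Decidable₂ _~_)
                            (isPER : IsPartialEquivalence _~_) where
    open IsPartialEquivalence isPER renaming (sym to ~-sym; trans to ~-trans)
    open ≡-Reasoning

    Minimal : Pred (Fin n) r
    Minimal i = i ~ i × (∀ j → i ~ j → i Fin.≤ j)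

    minimal? : Decidable Minimal
    minimal? i = (i ~? i) ×-dec Fin.all? (λ j → (i ~? j) →-dec (i Fin.≤? j))

    unique-minimal : ∀ {j} → j ~ j → sum (λ i → 𝟙 (minimal? i ×-dec i ~? j)) ≡ 1
    unique-minimal {j} j~j with least (_~? j) (j , j~j)
    ... | i , i~j , i-least =
      sum-unique (λ i → minimal? i ×-dec i ~? j)
        ((~-trans i~j (~-sym i~j) , λ k i~k → i-least (~-trans (~-sym i~k) i~j)) , i~j)
        (λ { ((_ , i′-min) , i′~j) → Fin.≤-antisym (i′-min i (~-trans i′~j (~-sym i~j))) (i-least i′~j) })

    uniformClassSize⇒∣ : ∀ k → (∀ {i} → i ~ i → sum (λ j → 𝟙 (i ~? j)) ≡ k) → k ∣ sum (λ i → 𝟙 (i ~? i))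
    uniformClassSize⇒∣ k classSize = divides (sum (𝟙 ∘ minimal?)) (begin
      sum (λ j → 𝟙 (j ~? j))                               ≡⟨ sum-cong-≗ by-representative ⟩
      sum (λ j → sum (λ i → 𝟙 (minimal? i ×-dec i ~? j)))  ≡⟨ ∑-comm (λ j i → 𝟙 (minimal? i ×-dec i ~? j)) ⟩
      sum (λ i → sum (λ j → 𝟙 (minimal? i ×-dec i ~? j)))  ≡⟨ sum-cong-≗ class ⟩
      sum (λ i → 𝟙 (minimal? i) * k)                       ≡⟨ *-distribʳ-sum k (𝟙 ∘ minimal?) ⟨
      sum (𝟙 ∘ minimal?) * k                               ∎)
      where
      by-representative : ∀ j → 𝟙 (j ~? j) ≡ sum (λ i → 𝟙 (minimal? i ×-dec i ~? j))
      by-representative j with j ~? j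
      ... | yes j~j = sym (unique-minimal j~j)
      ... | no ¬j~j = sym (trans (sum-cong-≗ (λ i → 𝟙-no (minimal? i ×-dec i ~? j) (¬j~j ∘ codomain ∘ proj₂)))
                                 (sum-replicate-zero n))
        where
        codomain : ∀ {i} → i ~ j → j ~ j
        codomain i~j = ~-trans (~-sym i~j) i~j
      class : ∀ i → sum (λ j → 𝟙 (minimal? i ×-dec i ~? j)) ≡ 𝟙 (minimal? i) * k
      class i = begin
        sum (λ j → 𝟙 (minimal? i ×-dec i ~? j))  ≡⟨ sum-cong-≗ (λ j → 𝟙-× (minimal? i) (i ~? j)) ⟩
        sum (λ j → 𝟙 (minimal? i) * 𝟙 (i ~? j))  ≡⟨ *-distribˡ-sum (𝟙 (minimal? i)) (λ j → 𝟙 (i ~? j)) ⟨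
        𝟙 (minimal? i) * sum (λ j → 𝟙 (i ~? j))  ≡⟨ 𝟙*-cong (minimal? i) (classSize ∘ proj₁) ⟩
        𝟙 (minimal? i) * k                       ∎

  repunit : ℕ → ℕ → ℕ
  repunit b zero    = 0
  repunit b (suc n) = 1 + b * repunit b n

  suc[d]^n≡1+d*repunit : ∀ d n → suc d ^ n ≡ 1 + d * repunit (suc d) n
  suc[d]^n≡1+d*repunit d zero    = cong suc (sym (*-zeroʳ d))
  suc[d]^n≡1+d*repunit d (suc n) = trans (cong (suc d *_) (suc[d]^n≡1+d*repunit d n)) (expand d (repunit (suc d) n))
    where
    expand : ∀ d r → (1 + d) * (1 + d * r) ≡ 1 + d * (1 + (1 + d) * r)
    expand = solve-∀

  even⊎odd : ∀ m → 2 ∣ m ⊎ 2 ∣ suc m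
  even⊎odd zero    = inj₁ (divides 0 refl)
  even⊎odd (suc m) with even⊎odd m
  ... | inj₁ 2∣m   = inj₂ (∣m∣n⇒∣m+n (divides 1 refl) 2∣m)
  ... | inj₂ 2∣1+m = inj₁ 2∣1+m

  ¬2∣1 : ¬ 2 ∣ 1
  ¬2∣1 2∣1 with ∣1⇒≡1 2∣1
  ... | ()

  odd⇒even-pred : ∀ {d} → ¬ 2 ∣ suc d → 2 ∣ d
  odd⇒even-pred {d} 1+d-odd with even⊎odd d
  ... | inj₁ 2∣d   = 2∣d
  ... | inj₂ 2∣1+d = ⊥-elim (1+d-odd 2∣1+d)

  2∣repunit+n : ∀ {d} → 2 ∣ d → ∀ n → 2 ∣ repunit (suc d) n + n
  2∣repunit+n         2∣d zero    = divides 0 refl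
  2∣repunit+n {d} 2∣d (suc n) = subst (2 ∣_) (regroup d (repunit (suc d) n) n)
    (∣m∣n⇒∣m+n (divides 1 refl) (∣m∣n⇒∣m+n (∣m⇒∣m*n _ 2∣d) (2∣repunit+n 2∣d n)))
    where
    regroup : ∀ d r n → 2 + (d * r + (r + n)) ≡ 1 + (1 + d) * r + suc n
    regroup = solve-∀

  odd^n : ∀ {q} n → ¬ 2 ∣ q → ¬ 2 ∣ q ^ n
  odd^n {zero}  n q-odd 2∣q^n = q-odd (divides 0 refl)
  odd^n {suc d} n q-odd 2∣q^n =
    ¬2∣1 (∣m+n∣m⇒∣n (subst (2 ∣_) (trans (suc[d]^n≡1+d*repunit d n) (+-comm 1 _)) 2∣q^n)
                    (∣m⇒∣m*n _ (odd⇒even-pred q-odd)))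

  [q∸1]*2∤qⁿ∸1 : ∀ {q n} → 1 < q → ¬ 2 ∣ q → ¬ 2 ∣ n → ¬ (q ∸ 1) * 2 ∣ q ^ n ∸ 1
  [q∸1]*2∤qⁿ∸1 {suc zero} (s≤s ())
  [q∸1]*2∤qⁿ∸1 {suc d@(suc _)} {n} _ q-odd n-odd d*2∣qⁿ∸1 =
    n-odd (∣m+n∣m⇒∣n (2∣repunit+n (odd⇒even-pred q-odd) n) 2∣repunit)
    where
    2∣repunit : 2 ∣ repunit (suc d) n
    2∣repunit = *-cancelˡ-∣ d (subst (d * 2 ∣_) (cong (_∸ 1) (suc[d]^n≡1+d*repunit d n)) d*2∣qⁿ∸1)

  primePower>1 : ∀ {q} → IsPrimePower q → 1 < q
  primePower>1 (p , k , p-prime , refl) =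
    <-≤-trans (nonTrivial⇒n>1 p) (m≤m*n p (p ^ k) {{m^n≢0 p k {{nonTrivial⇒nonZero p}}}})
    where
    instance
      p-nonTrivial : NonTrivial p
      p-nonTrivial = prime⇒nonTrivial p-prime

  module Counting {c ℓ} (K : CommutativeRing c ℓ) {N} (E : Enumeration K N) where
    open CommutativeRing K using (Carrier; _≈_)
      renaming (refl to ≈-refl; sym to ≈-sym; trans to ≈-trans; reflexive to ≈-reflexive)
    open Enumeration E
    open ≡-Reasoning

    index : Carrier → Fin N
    index x = proj₁ (enum-surj x)

    enum-index : ∀ x → enum (index x) ≈ x
    enum-index x = proj₂ (enum-surj x)

    index-cong : ∀ {x y} → x ≈ y → index x ≡ index y
    index-cong {x} {y} x≈y = enum-inj _ _ (≈-trans (enum-index x) (≈-trans x≈y (≈-sym (enum-index y))))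

    infix 4 _≟_
    _≟_ : Decidable₂ _≈_
    x ≟ y = map′ (λ eq → ≈-trans (≈-sym (enum-index x)) (≈-trans (≈-reflexive (cong enum eq)) (enum-index y)))
                 index-cong (index x Fin.≟ index y)

    ∑ : (Carrier → ℕ) → ℕ
    ∑ f = sum (f ∘ enum)

    # : ∀ {p} {P : Pred Carrier p} → Decidable P → ℕ
    # P? = ∑ (𝟙 ∘ P?)

    count≡# : ∀ {p} {P : Pred Carrier p} (P? : Decidable P) → count K E P? ≡ # P?
    count≡# P? = length-filter-tabulate (P? ∘ enum) id

    ∑-cong : ∀ {f g} → (∀ x → f x ≡ g x) → ∑ f ≡ ∑ g
    ∑-cong f≗g = sum-cong-≗ (f≗g ∘ enum)

    ∑-1 : ∑ (λ _ → 1) ≡ N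
    ∑-1 = sum-1 N

    ∑-+ : ∀ f g → ∑ (λ x → f x + g x) ≡ ∑ f + ∑ g
    ∑-+ f g = ∑-distrib-+ (f ∘ enum) (g ∘ enum)

    ∑-*ʳ : ∀ k f → ∑ (λ x → f x * k) ≡ ∑ f * k
    ∑-*ʳ k f = sym (*-distribʳ-sum k (f ∘ enum))

    ∑-≤-≡ : ∀ {f g} → f Preserves _≈_ ⟶ _≡_ → g Preserves _≈_ ⟶ _≡_ →
            (∀ x → f x ≤ g x) → ∑ f ≡ ∑ g → ∀ x → f x ≡ g x
    ∑-≤-≡ {f} {g} f-cong g-cong f≤g Σf≡Σg x = begin
      f x                  ≡⟨ f-cong (enum-index x) ⟨
      f (enum (index x))   ≡⟨ sum-≤-≡ (f≤g ∘ enum) Σf≡Σg (index x) ⟩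
      g (enum (index x))   ≡⟨ g-cong (enum-index x) ⟩
      g x                  ∎

    module _ {p} {P : Pred Carrier p} (P? : Decidable P) where

      #-cong : ∀ {q} {Q : Pred Carrier q} (Q? : Decidable Q) →
               (∀ {x} → P x → Q x) → (∀ {x} → Q x → P x) → # P? ≡ # Q?
      #-cong Q? P⇒Q Q⇒P = ∑-cong (λ x → 𝟙-cong P⇒Q Q⇒P (P? x) (Q? x))

      #-zero : (∀ x → ¬ P x) → # P? ≡ 0
      #-zero ¬P = trans (∑-cong (λ x → 𝟙-no (P? x) (¬P x))) (sum-replicate-zero N)

      #-unique : P Respects _≈_ → ∀ {a} → P a → (∀ {x} → P x → x ≈ a) → # P? ≡ 1
      #-unique resp {a} pₐ unique = sum-unique (P? ∘ enum) (resp (≈-sym (enum-index a)) pₐ)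
        (λ {j} pⱼ → enum-inj _ _ (≈-trans (unique pⱼ) (≈-sym (enum-index a))))

      𝟙∘-cong : P Respects _≈_ → (𝟙 ∘ P?) Preserves _≈_ ⟶ _≡_
      𝟙∘-cong resp x≈y = 𝟙-cong (resp x≈y) (resp (≈-sym x≈y)) (P? _) (P? _)

      #-¬ : # (¬? ∘ P?) ≡ N ∸ # P?
      #-¬ = begin
        # (¬? ∘ P?)                                ≡⟨ m+n∸n≡m (# (¬? ∘ P?)) (# P?) ⟨
        # (¬? ∘ P?) + # P? ∸ # P?                  ≡⟨ cong (_∸ # P?) (∑-+ (𝟙 ∘ ¬? ∘ P?) (𝟙 ∘ P?)) ⟨
        ∑ (λ x → 𝟙 (¬? (P? x)) + 𝟙 (P? x)) ∸ # P?  ≡⟨ cong (_∸ # P?) (trans (∑-cong (𝟙-¬ ∘ P?)) ∑-1) ⟩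
        N ∸ # P?                                   ∎

      #-split : ∀ {q} {Q : Pred Carrier q} (Q? : Decidable Q) →
                # (λ x → P? x ×-dec ¬? (Q? x)) ≡ # P? ∸ # (λ x → P? x ×-dec Q? x)
      #-split {Q = Q} Q? = begin
        #P∖Q                                      ≡⟨ m+n∸n≡m #P∖Q #P∩Q ⟨
        #P∖Q + #P∩Q ∸ #P∩Q                        ≡⟨ cong (_∸ #P∩Q) (∑-+ (𝟙 ∘ P∖Q?) (𝟙 ∘ P∩Q?)) ⟨
        ∑ (λ x → 𝟙 (P∖Q? x) + 𝟙 (P∩Q? x)) ∸ #P∩Q  ≡⟨ cong (_∸ #P∩Q) (∑-cong split) ⟩
        # P? ∸ #P∩Q                               ∎
        where
        P∖Q? : Decidable (λ x → P x × ¬ Q x)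
        P∩Q? : Decidable (λ x → P x × Q x)
        P∖Q? x = P? x ×-dec ¬? (Q? x)
        P∩Q? x = P? x ×-dec Q? x

        #P∖Q #P∩Q : ℕ
        #P∖Q = # P∖Q?
        #P∩Q = # P∩Q?

        split : ∀ x → 𝟙 (P∖Q? x) + 𝟙 (P∩Q? x) ≡ 𝟙 (P? x)
        split x = begin
          𝟙 (P∖Q? x) + 𝟙 (P∩Q? x)                          ≡⟨ cong₂ _+_ (𝟙-× (P? x) (¬? (Q? x))) (𝟙-× (P? x) (Q? x)) ⟩
          𝟙 (P? x) * 𝟙 (¬? (Q? x)) + 𝟙 (P? x) * 𝟙 (Q? x)  ≡⟨ *-distribˡ-+ (𝟙 (P? x)) _ _ ⟨
          𝟙 (P? x) * (𝟙 (¬? (Q? x)) + 𝟙 (Q? x))           ≡⟨ cong (𝟙 (P? x) *_) (𝟙-¬ (Q? x)) ⟩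
          𝟙 (P? x) * 1                                     ≡⟨ *-identityʳ _ ⟩
          𝟙 (P? x)                                         ∎

    #-pair : ∀ {a b} → ¬ a ≈ b → # (λ x → (x ≟ a) ⊎-dec (x ≟ b)) ≡ 2
    #-pair {a} {b} a≉b = begin
      # (λ x → (x ≟ a) ⊎-dec (x ≟ b))  ≡⟨ ∑-cong (λ x → 𝟙-⊎ not-both (x ≟ a) (x ≟ b)) ⟩
      ∑ (λ x → 𝟙 (x ≟ a) + 𝟙 (x ≟ b))  ≡⟨ ∑-+ (𝟙 ∘ (_≟ a)) (𝟙 ∘ (_≟ b)) ⟩
      # (_≟ a) + # (_≟ b)              ≡⟨ cong₂ _+_ (#-singleton a) (#-singleton b) ⟩
      2                                ∎
      where
      not-both : ∀ {x} → ¬ (x ≈ a × x ≈ b)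
      not-both (x≈a , x≈b) = a≉b (≈-trans (≈-sym x≈a) x≈b)

      #-singleton : ∀ a → # (_≟ a) ≡ 1
      #-singleton a = #-unique (_≟ a) (λ y≈x x≈a → ≈-trans (≈-sym y≈x) x≈a) ≈-refl id

    ∑-δ : ∀ {g} → g Preserves _≈_ ⟶ _≡_ → ∀ a → ∑ (λ x → 𝟙 (a ≟ x) * g x) ≡ g a
    ∑-δ {g} g-cong a = begin
      ∑ (λ x → 𝟙 (a ≟ x) * g x)  ≡⟨ ∑-cong (λ x → 𝟙*-cong (a ≟ x) (g-cong ∘ ≈-sym)) ⟩
      ∑ (λ x → 𝟙 (a ≟ x) * g a)  ≡⟨ *-distribʳ-sum (g a) (𝟙 ∘ (a ≟_) ∘ enum) ⟨
      # (a ≟_) * g a             ≡⟨ cong (_* g a) (#-unique (a ≟_) (λ x≈y a≈x → ≈-trans a≈x x≈y) ≈-refl ≈-sym) ⟩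
      1 * g a                    ≡⟨ *-identityˡ (g a) ⟩
      g a                        ∎

    ∑-fibres : ∀ (φ : Carrier → Carrier) {g} → g Preserves _≈_ ⟶ _≡_ →
               ∑ (g ∘ φ) ≡ ∑ (λ x → g x * # (λ y → φ y ≟ x))
    ∑-fibres φ {g} g-cong = begin
      ∑ (g ∘ φ)                              ≡⟨ ∑-cong (λ y → ∑-δ g-cong (φ y)) ⟨
      ∑ (λ y → ∑ (λ x → 𝟙 (φ y ≟ x) * g x))  ≡⟨ ∑-comm (λ i j → 𝟙 (φ (enum i) ≟ enum j) * g (enum j)) ⟩
      ∑ (λ x → ∑ (λ y → 𝟙 (φ y ≟ x) * g x))  ≡⟨ ∑-cong (λ x → *-distribʳ-sum (g x) (λ j → 𝟙 (φ (enum j) ≟ x))) ⟨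
      ∑ (λ x → # (λ y → φ y ≟ x) * g x)      ≡⟨ ∑-cong (λ x → *-comm (# (λ y → φ y ≟ x)) (g x)) ⟩
      ∑ (λ x → g x * # (λ y → φ y ≟ x))      ∎

    ∑-inverse : ∀ (φ ψ : Carrier → Carrier) → φ Preserves _≈_ ⟶ _≈_ → ψ Preserves _≈_ ⟶ _≈_ →
                (∀ x → φ (ψ x) ≈ x) → (∀ y → ψ (φ y) ≈ y) →
                ∀ {g} → g Preserves _≈_ ⟶ _≡_ → ∑ (g ∘ φ) ≡ ∑ g
    ∑-inverse φ ψ φ-cong ψ-cong φψ ψφ {g} g-cong = begin
      ∑ (g ∘ φ)                          ≡⟨ ∑-fibres φ g-cong ⟩
      ∑ (λ x → g x * # (λ y → φ y ≟ x))  ≡⟨ ∑-cong (λ x → cong (g x *_) (#-fibre x)) ⟩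
      ∑ (λ x → g x * 1)                  ≡⟨ ∑-cong (*-identityʳ ∘ g) ⟩
      ∑ g                                ∎
      where
      #-fibre : ∀ x → # (λ y → φ y ≟ x) ≡ 1
      #-fibre x = #-unique (λ y → φ y ≟ x) (λ y≈y′ φy≈x → ≈-trans (φ-cong (≈-sym y≈y′)) φy≈x) (φψ x)
                           (λ φy≈x → ≈-trans (≈-sym (ψφ _)) (ψ-cong φy≈x))

module DecidableField {c ℓ} (K : CommutativeRing c ℓ) (isField : IsField K)
                      (_≟_ : Decidable₂ (CommutativeRing._≈_ K)) where
  open CommutativeRing K
  open import Algebra.Properties.Ring ring using (-‿distribˡ-*; -‿distribʳ-*; [y-z]x≈yx-zx)
  open import Algebra.Properties.AbelianGroup +-abelianGroup using (⁻¹-involutive; x∙y⁻¹≈ε⇒x≈y; inverseˡ-unique)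
  open import Relation.Binary.Reasoning.Setoid setoid

  1≉0 : ¬ 1# ≈ 0#
  1≉0 = proj₁ isField

  -- junk value: inv 0# = 0#
  inv : Carrier → Carrier
  inv x with x ≟ 0#
  ... | yes _   = 0#
  ... | no x≉0 = proj₁ (proj₂ isField x x≉0)

  x*inv[x]≈1 : ∀ {x} → ¬ x ≈ 0# → x * inv x ≈ 1#
  x*inv[x]≈1 {x} x≉0 with x ≟ 0#
  ... | yes x≈0  = ⊥-elim (x≉0 x≈0)
  ... | no x≉0′ = proj₂ (proj₂ isField x x≉0′)

  inv[x]*x≈1 : ∀ {x} → ¬ x ≈ 0# → inv x * x ≈ 1#
  inv[x]*x≈1 x≉0 = trans (*-comm _ _) (x*inv[x]≈1 x≉0)

  inv[x]*[x*y]≈y : ∀ {x} → ¬ x ≈ 0# → ∀ y → inv x * (x * y) ≈ y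
  inv[x]*[x*y]≈y {x} x≉0 y = begin
    inv x * (x * y)  ≈⟨ *-assoc _ _ _ ⟨
    inv x * x * y    ≈⟨ *-congʳ (inv[x]*x≈1 x≉0) ⟩
    1# * y           ≈⟨ *-identityˡ y ⟩
    y                ∎

  x*[inv[x]*y]≈y : ∀ {x} → ¬ x ≈ 0# → ∀ y → x * (inv x * y) ≈ y
  x*[inv[x]*y]≈y {x} x≉0 y = begin
    x * (inv x * y)  ≈⟨ *-assoc _ _ _ ⟨
    x * inv x * y    ≈⟨ *-congʳ (x*inv[x]≈1 x≉0) ⟩
    1# * y           ≈⟨ *-identityˡ y ⟩
    y                ∎

  inv[x]≉0 : ∀ {x} → ¬ x ≈ 0# → ¬ inv x ≈ 0#
  inv[x]≉0 {x} x≉0 inv[x]≈0 = 1≉0 (begin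
    1#         ≈⟨ x*inv[x]≈1 x≉0 ⟨
    x * inv x  ≈⟨ *-congˡ inv[x]≈0 ⟩
    x * 0#     ≈⟨ zeroʳ x ⟩
    0#         ∎)

  x*y≈0⇒x≈0⊎y≈0 : ∀ {x y} → x * y ≈ 0# → x ≈ 0# ⊎ y ≈ 0#
  x*y≈0⇒x≈0⊎y≈0 {x} {y} xy≈0 with x ≟ 0#
  ... | yes x≈0 = inj₁ x≈0
  ... | no x≉0  = inj₂ (begin
    y                ≈⟨ inv[x]*[x*y]≈y x≉0 y ⟨
    inv x * (x * y)  ≈⟨ *-congˡ xy≈0 ⟩
    inv x * 0#       ≈⟨ zeroʳ _ ⟩
    0#               ∎)

  x*y≉0 : ∀ {x y} → ¬ x ≈ 0# → ¬ y ≈ 0# → ¬ x * y ≈ 0#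
  x*y≉0 x≉0 y≉0 xy≈0 with x*y≈0⇒x≈0⊎y≈0 xy≈0
  ... | inj₁ x≈0 = x≉0 x≈0
  ... | inj₂ y≈0 = y≉0 y≈0

  x*x≈0⇒x≈0 : ∀ {x} → x * x ≈ 0# → x ≈ 0#
  x*x≈0⇒x≈0 {x} xx≈0 with x ≟ 0#
  ... | yes x≈0 = x≈0
  ... | no x≉0  = ⊥-elim (x*y≉0 x≉0 x≉0 xx≈0)

  x≈0⇒x*y≈0 : ∀ {x} y → x ≈ 0# → x * y ≈ 0#
  x≈0⇒x*y≈0 y x≈0 = trans (*-congʳ x≈0) (zeroˡ y)

  -x*-x≈x*x : ∀ x → - x * - x ≈ x * x
  -x*-x≈x*x x = begin
    - x * - x      ≈⟨ -‿distribˡ-* x (- x) ⟨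
    - (x * - x)    ≈⟨ -‿cong (-‿distribʳ-* x x) ⟨
    - (- (x * x))  ≈⟨ ⁻¹-involutive (x * x) ⟩
    x * x          ∎

  [x-y]*[x+y]≈x*x-y*y : ∀ x y → (x - y) * (x + y) ≈ x * x - y * y
  [x-y]*[x+y]≈x*x-y*y x y = begin
    (x - y) * (x + y)                    ≈⟨ distribˡ (x - y) x y ⟩
    (x - y) * x + (x - y) * y            ≈⟨ +-cong ([y-z]x≈yx-zx x x y) ([y-z]x≈yx-zx y x y) ⟩
    (x * x - y * x) + (x * y - y * y)    ≈⟨ +-congʳ (+-congˡ (-‿cong (*-comm y x))) ⟩
    (x * x - x * y) + (x * y - y * y)    ≈⟨ +-assoc (x * x) (- (x * y)) _ ⟩
    x * x + (- (x * y) + (x * y - y * y)) ≈⟨ +-congˡ (+-assoc (- (x * y)) (x * y) _) ⟨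
    x * x + ((- (x * y) + x * y) - y * y) ≈⟨ +-congˡ (+-congʳ (-‿inverseˡ (x * y))) ⟩
    x * x + (0# - y * y)                 ≈⟨ +-congˡ (+-identityˡ _) ⟩
    x * x - y * y                        ∎

  x*x≈y*y⇒x≈y⊎x≈-y : ∀ {x y} → x * x ≈ y * y → x ≈ y ⊎ x ≈ - y
  x*x≈y*y⇒x≈y⊎x≈-y {x} {y} xx≈yy with x*y≈0⇒x≈0⊎y≈0 (begin
    (x - y) * (x + y)  ≈⟨ [x-y]*[x+y]≈x*x-y*y x y ⟩
    x * x - y * y      ≈⟨ +-congʳ xx≈yy ⟩
    y * y - y * y      ≈⟨ -‿inverseʳ (y * y) ⟩
    0#                 ∎)
  ... | inj₁ x-y≈0 = inj₁ (x∙y⁻¹≈ε⇒x≈y x y x-y≈0)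
  ... | inj₂ x+y≈0 = inj₂ (inverseˡ-unique x y x+y≈0)

  x≉0⇒x≉-x : ¬ 1# + 1# ≈ 0# → ∀ {x} → ¬ x ≈ 0# → ¬ x ≈ - x
  x≉0⇒x≉-x 1+1≉0 {x} x≉0 x≈-x = x*y≉0 1+1≉0 x≉0 (begin
    (1# + 1#) * x    ≈⟨ distribʳ x 1# 1# ⟩
    1# * x + 1# * x  ≈⟨ +-cong (*-identityˡ x) (*-identityˡ x) ⟩
    x + x            ≈⟨ +-congˡ x≈-x ⟩
    x - x            ≈⟨ -‿inverseʳ x ⟩
    0#               ∎)

module FiniteField {r ℓ} (K : CommutativeRing r ℓ) (isField : IsField K) {N} (E : Enumeration K N) where
  open CommutativeRing K
  open Enumeration E
  open Counting K E
  open DecidableField K isField _≟_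
  open import Algebra.Properties.AbelianGroup +-abelianGroup using (identityʳ-unique)
  open import Algebra.Properties.CommutativeSemigroup *-commutativeSemigroup using (interchange)
  open import Algebra.Solver.CommutativeMonoid *-commutativeMonoid using (solve; _⊕_; _⊜_)
  module ≈-Reasoning = SetoidReasoning setoid

  ∑-scale : ∀ {a} → ¬ a ≈ 0# → ∀ {g} → g Preserves _≈_ ⟶ _≡_ → ∑ (λ x → g (a * x)) ≡ ∑ g
  ∑-scale a≉0 = ∑-inverse (_ *_) (inv _ *_) *-congˡ *-congˡ (x*[inv[x]*y]≈y a≉0) (inv[x]*[x*y]≈y a≉0)

  1+1≈0⇒2∣N : 1# + 1# ≈ 0# → 2 ∣ N
  1+1≈0⇒2∣N 1+1≈0 = ≡.subst (2 ∣_) (≡.trans (sum-cong-≗ (λ i → 𝟙-yes (i ~? i) (inj₁ refl))) ∑-1)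
                                   (uniformClassSize⇒∣ 2 (λ {i} _ → #-pair (x≉x+1 (enum i))))
    where
    x+1+1≈x : ∀ x → x + 1# + 1# ≈ x
    x+1+1≈x x = begin
      x + 1# + 1#    ≈⟨ +-assoc x 1# 1# ⟩
      x + (1# + 1#)  ≈⟨ +-congˡ 1+1≈0 ⟩
      x + 0#         ≈⟨ +-identityʳ x ⟩
      x              ∎
      where open ≈-Reasoning

    x≉x+1 : ∀ x → ¬ x ≈ x + 1#
    x≉x+1 x x≈x+1 = 1≉0 (identityʳ-unique x 1# (sym x≈x+1))

    _∼_ : Rel Carrier ℓ
    x ∼ y = y ≈ x ⊎ y ≈ x + 1#

    ∼-sym : ∀ {x y} → x ∼ y → y ∼ x
    ∼-sym (inj₁ y≈x)   = inj₁ (sym y≈x)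
    ∼-sym (inj₂ y≈x+1) = inj₂ (trans (sym (x+1+1≈x _)) (+-congʳ (sym y≈x+1)))

    ∼-trans : ∀ {x y z} → x ∼ y → y ∼ z → x ∼ z
    ∼-trans (inj₁ y≈x)   (inj₁ z≈y)   = inj₁ (trans z≈y y≈x)
    ∼-trans (inj₁ y≈x)   (inj₂ z≈y+1) = inj₂ (trans z≈y+1 (+-congʳ y≈x))
    ∼-trans (inj₂ y≈x+1) (inj₁ z≈y)   = inj₂ (trans z≈y y≈x+1)
    ∼-trans (inj₂ y≈x+1) (inj₂ z≈y+1) = inj₁ (trans z≈y+1 (trans (+-congʳ y≈x+1) (x+1+1≈x _)))

    _~?_ : Decidable₂ (_∼_ on enum)
    i ~? j = (enum j ≟ enum i) ⊎-dec (enum j ≟ enum i + 1#)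

    isPER : IsPartialEquivalence (_∼_ on enum)
    isPER = record { sym = ∼-sym ; trans = ∼-trans }

    open PartialEquivalence _~?_ isPER

  IsSquare : Pred Carrier (r ⊔ ℓ)
  IsSquare x = ∃ λ y → y * y ≈ x

  isSquare? : Decidable IsSquare
  isSquare? x = map′ (λ (i , ii≈x) → enum i , ii≈x)
                     (λ (y , yy≈x) → index y , trans (*-cong (enum-index y) (enum-index y)) yy≈x)
                     (Fin.any? (λ i → enum i * enum i ≟ x))

  IsSquare-resp : IsSquare Respects _≈_
  IsSquare-resp x≈x′ (y , yy≈x) = y , trans yy≈x x≈x′

  nonsquare⇒≉0 : ∀ {x} → ¬ IsSquare x → ¬ x ≈ 0#
  nonsquare⇒≉0 ¬□x x≈0 = ¬□x (0# , trans (zeroˡ 0#) (sym x≈0))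

  rootCount : Carrier → ℕ
  rootCount x = # (λ y → y * y ≟ x)

  rootCount-cong : rootCount Preserves _≈_ ⟶ _≡_
  rootCount-cong {x} {x′} x≈x′ =
    #-cong (λ y → y * y ≟ x) (λ y → y * y ≟ x′) (λ yy≈x → trans yy≈x x≈x′) (λ yy≈x′ → trans yy≈x′ (sym x≈x′))

  rootCount-nonsquare : ∀ {x} → ¬ IsSquare x → rootCount x ≡ 0
  rootCount-nonsquare {x} ¬□x = #-zero (λ y → y * y ≟ x) (λ y yy≈x → ¬□x (y , yy≈x))

  rootCount-zero : ∀ {x} → x ≈ 0# → rootCount x ≡ 1
  rootCount-zero {x} x≈0 = #-unique (λ y → y * y ≟ x) (λ y≈y′ yy≈x → trans (*-cong (sym y≈y′) (sym y≈y′)) yy≈x)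
                                    (trans (zeroˡ 0#) (sym x≈0)) (λ yy≈x → x*x≈0⇒x≈0 (trans yy≈x x≈0))

  rootCount-square : ¬ 1# + 1# ≈ 0# → ∀ {a} → ¬ a ≈ 0# → rootCount (a * a) ≡ 2
  rootCount-square 1+1≉0 {a} a≉0 = ≡.trans
    (#-cong (λ y → y * y ≟ a * a) (λ y → (y ≟ a) ⊎-dec (y ≟ - a)) x*x≈y*y⇒x≈y⊎x≈-y
            λ { (inj₁ y≈a)  → *-cong y≈a y≈a
              ; (inj₂ y≈-a) → trans (*-cong y≈-a y≈-a) (-x*-x≈x*x a) })
    (#-pair (x≉0⇒x≉-x 1+1≉0 a≉0))

  rootCount≤2 : ¬ 1# + 1# ≈ 0# → ∀ x → rootCount x ≤ 2
  rootCount≤2 1+1≉0 x with isSquare? x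
  ... | no ¬□x = ℕₚ.≤-trans (ℕₚ.≤-reflexive (rootCount-nonsquare ¬□x)) z≤n
  ... | yes (a , aa≈x) with a ≟ 0#
  ...   | yes a≈0 = ℕₚ.≤-trans (ℕₚ.≤-reflexive (rootCount-zero (trans (sym aa≈x) (x≈0⇒x*y≈0 a a≈0)))) (s≤s z≤n)
  ...   | no a≉0  = ℕₚ.≤-reflexive (≡.trans (rootCount-cong (sym aa≈x)) (rootCount-square 1+1≉0 a≉0))

  ∑-rootCount : ∑ rootCount ≡ N
  ∑-rootCount = ≡.trans (∑-cong (λ x → ≡.sym (ℕₚ.*-identityˡ (rootCount x))))
                        (≡.trans (≡.sym (∑-fibres (λ y → y * y) (λ _ → ≡.refl))) ∑-1)

  module _ {h} {H : Pred Carrier h} (H? : Decidable H) (H-resp : H Respects _≈_) (H-1 : H 1#)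
           (H-* : ∀ {x y} → H x → H y → H (x * y)) (H-inv : ∀ {x y} → x * y ≈ 1# → H x → H y)
           (H⊆K* : ∀ {x} → H x → ¬ x ≈ 0#) where

    lagrange : # H? ∣ # (λ x → ¬? (x ≟ 0#))
    lagrange = ≡.subst (# H? ∣_) domain (uniformClassSize⇒∣ (# H?) classSize)
      where
      _∼_ : Rel Carrier (ℓ ⊔ h)
      x ∼ y = ¬ x ≈ 0# × H (inv x * y)

      ∼-sym : ∀ {x y} → x ∼ y → y ∼ x
      ∼-sym {x} {y} (x≉0 , h) = y≉0 , H-inv (begin
        (inv x * y) * (inv y * x)  ≈⟨ solve 4 (λ x′ y y′ x → (x′ ⊕ y) ⊕ (y′ ⊕ x) ⊜ (x′ ⊕ x) ⊕ (y′ ⊕ y))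
                                              refl (inv x) y (inv y) x ⟩
        (inv x * x) * (inv y * y)  ≈⟨ *-cong (inv[x]*x≈1 x≉0) (inv[x]*x≈1 y≉0) ⟩
        1# * 1#                    ≈⟨ *-identityˡ 1# ⟩
        1#                         ∎) h
        where
        open ≈-Reasoning
        y≉0 : ¬ y ≈ 0#
        y≉0 y≈0 = H⊆K* h (trans (*-congˡ y≈0) (zeroʳ (inv x)))

      ∼-trans : ∀ {x y z} → x ∼ y → y ∼ z → x ∼ z
      ∼-trans {x} {y} {z} (x≉0 , h) (y≉0 , h′) = x≉0 , H-resp (begin
        (inv x * y) * (inv y * z)  ≈⟨ solve 4 (λ x′ y y′ z → (x′ ⊕ y) ⊕ (y′ ⊕ z) ⊜ (x′ ⊕ z) ⊕ (y′ ⊕ y))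
                                              refl (inv x) y (inv y) z ⟩
        (inv x * z) * (inv y * y)  ≈⟨ *-congˡ (inv[x]*x≈1 y≉0) ⟩
        (inv x * z) * 1#           ≈⟨ *-identityʳ _ ⟩
        inv x * z                  ∎) (H-* h h′)
        where open ≈-Reasoning

      _~?_ : Decidable₂ (_∼_ on enum)
      i ~? j = ¬? (enum i ≟ 0#) ×-dec H? (inv (enum i) * enum j)

      isPER : IsPartialEquivalence (_∼_ on enum)
      isPER = record { sym = ∼-sym ; trans = ∼-trans }

      open PartialEquivalence _~?_ isPER

      domain : sum (λ i → 𝟙 (i ~? i)) ≡ # (λ x → ¬? (x ≟ 0#))
      domain = sum-cong-≗ λ i → 𝟙-cong proj₁ (λ x≉0 → x≉0 , H-resp (sym (inv[x]*x≈1 x≉0)) H-1)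
                                       (i ~? i) (¬? (enum i ≟ 0#))

      classSize : ∀ {i} → enum i ∼ enum i → sum (λ j → 𝟙 (i ~? j)) ≡ # H?
      classSize {i} (x≉0 , _) = ≡.trans (sum-cong-≗ (λ j → 𝟙-cong proj₂ (x≉0 ,_) (i ~? j) (H? (inv (enum i) * enum j))))
                                        (∑-scale (inv[x]≉0 x≉0) (𝟙∘-cong H? H-resp))

  module _ {p} (F : Subfield K p) where
    private module F = Subfield F

    F* : Pred Carrier (p ⊔ ℓ)
    F* x = F.mem x × ¬ x ≈ 0#

    F*? : Decidable F*
    F*? x = F.dec x ×-dec ¬? (x ≟ 0#)

    F*-resp : F* Respects _≈_
    F*-resp x≈y (fx , x≉0) = F.resp x≈y fx , λ y≈0 → x≉0 (trans x≈y y≈0)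

    #F*≡#F∸1 : # F*? ≡ # F.dec ∸ 1
    #F*≡#F∸1 = ≡.trans (#-split F.dec (_≟ 0#))
                       (≡.cong (# F.dec ∸_) (#-unique F∩0? F∩0-resp (F.zero-mem , refl) proj₂))
      where
      F∩0? : Decidable (λ x → F.mem x × x ≈ 0#)
      F∩0? x = F.dec x ×-dec (x ≟ 0#)

      F∩0-resp : (λ x → F.mem x × x ≈ 0#) Respects _≈_
      F∩0-resp x≈y (fx , x≈0) = F.resp x≈y fx , trans (sym x≈y) x≈0

    √F* : Pred Carrier (p ⊔ ℓ)
    √F* y = F* (y * y)

    √F*? : Decidable √F*
    √F*? y = F*? (y * y)

    #√F*≡#F*·2 : ¬ 1# + 1# ≈ 0# → (∀ {x} → F* x → IsSquare x) → # √F*? ≡ # F*? ℕ.* 2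
    #√F*≡#F*·2 1+1≉0 F*⊆□ = begin
      # √F*?                              ≡⟨ ∑-fibres (λ y → y * y) (𝟙∘-cong F*? F*-resp) ⟩
      ∑ (λ x → 𝟙 (F*? x) ℕ.* rootCount x)  ≡⟨ ∑-cong (λ x → 𝟙*-cong (F*? x) two-roots) ⟩
      ∑ (λ x → 𝟙 (F*? x) ℕ.* 2)            ≡⟨ ∑-*ʳ 2 (𝟙 ∘ F*?) ⟩
      # F*? ℕ.* 2                         ∎
      where
      open ≡.≡-Reasoning
      two-roots : ∀ {x} → F* x → rootCount x ≡ 2
      two-roots {x} (fx , x≉0) with F*⊆□ (fx , x≉0)
      ... | a , aa≈x = ≡.trans (rootCount-cong (sym aa≈x))
                               (rootCount-square 1+1≉0 (λ a≈0 → x≉0 (trans (sym aa≈x) (x≈0⇒x*y≈0 a a≈0))))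

    √F*-lagrange : # √F*? ∣ # (λ x → ¬? (x ≟ 0#))
    √F*-lagrange = lagrange √F*? (λ x≈y → F*-resp (*-cong x≈y x≈y)) √F*-1 √F*-* √F*-inv
                            (λ (_ , yy≉0) y≈0 → yy≉0 (x≈0⇒x*y≈0 _ y≈0))
      where
      open ≈-Reasoning
      √F*-1 : √F* 1#
      √F*-1 = F.resp (sym (*-identityʳ 1#)) F.one-mem , λ 11≈0 → 1≉0 (trans (sym (*-identityʳ 1#)) 11≈0)

      √F*-* : ∀ {x y} → √F* x → √F* y → √F* (x * y)
      √F*-* (fxx , xx≉0) (fyy , yy≉0) = F.resp (sym (interchange _ _ _ _)) (F.*-mem fxx fyy)
                                      , λ xyxy≈0 → x*y≉0 xx≉0 yy≉0 (trans (sym (interchange _ _ _ _)) xyxy≈0)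

      √F*-inv : ∀ {x y} → x * y ≈ 1# → √F* x → √F* y
      √F*-inv {x} {y} xy≈1 (fxx , _) = F.inv-mem fxx xxyy≈1 , λ yy≈0 → 1≉0 (begin
          1#                 ≈⟨ xxyy≈1 ⟨
          (x * x) * (y * y)  ≈⟨ *-congˡ yy≈0 ⟩
          (x * x) * 0#       ≈⟨ zeroʳ _ ⟩
          0#                 ∎)
        where
        xxyy≈1 : (x * x) * (y * y) ≈ 1#
        xxyy≈1 = begin
          (x * x) * (y * y)  ≈⟨ interchange x x y y ⟩
          (x * y) * (x * y)  ≈⟨ *-cong xy≈1 xy≈1 ⟩
          1# * 1#            ≈⟨ *-identityˡ 1# ⟩
          1#                 ∎

    subfield-nonsquare : ¬ 1# + 1# ≈ 0# → ∀ {q n} → # F.dec ≡ q → 1 < q → ¬ 2 ∣ q → N ≡ q ^ n → ¬ 2 ∣ n →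
                         ∃ λ c → F.mem c × ¬ IsSquare c
    subfield-nonsquare 1+1≉0 {q} {n} #F≡q 1<q q-odd N≡qⁿ n-odd
      with Fin.any? (λ i → F.dec (enum i) ×-dec ¬? (isSquare? (enum i)))
    ... | yes (i , c∈F , ¬□c) = enum i , c∈F , ¬□c
    ... | no ∄ = ⊥-elim ([q∸1]*2∤qⁿ∸1 1<q q-odd n-odd (≡.subst₂ _∣_ #√F*≡[q∸1]*2 #K*≡qⁿ∸1 √F*-lagrange))
      where
      F*⊆□ : ∀ {x} → F* x → IsSquare x
      F*⊆□ {x} (fx , _) with isSquare? x
      ... | yes □x = □x
      ... | no ¬□x = ⊥-elim (∄ (index x , F.resp (sym (enum-index x)) fx , ¬□x ∘ IsSquare-resp (enum-index x)))

      #√F*≡[q∸1]*2 : # √F*? ≡ (q ∸ 1) ℕ.* 2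
      #√F*≡[q∸1]*2 = ≡.trans (#√F*≡#F*·2 1+1≉0 F*⊆□) (≡.cong (ℕ._* 2) (≡.trans #F*≡#F∸1 (≡.cong (_∸ 1) #F≡q)))

      #K*≡qⁿ∸1 : # (λ x → ¬? (x ≟ 0#)) ≡ q ^ n ∸ 1
      #K*≡qⁿ∸1 = ≡.trans (#-¬ (_≟ 0#)) (≡.cong₂ _∸_ N≡qⁿ (#-unique (_≟ 0#) (λ x≈y x≈0 → trans (sym x≈y) x≈0) refl id))

  module _ (1+1≉0 : ¬ 1# + 1# ≈ 0#) {c} (c-nonsquare : ¬ IsSquare c) where
    private
      c≉0 : ¬ c ≈ 0#
      c≉0 = nonsquare⇒≉0 c-nonsquare

    c*x-nonsquare : ∀ {x} → IsSquare x → ¬ x ≈ 0# → ¬ IsSquare (c * x)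
    c*x-nonsquare {x} (a , aa≈x) x≉0 (b , bb≈cx) = c-nonsquare (b * inv a , (begin
      (b * inv a) * (b * inv a)        ≈⟨ interchange b (inv a) b (inv a) ⟩
      (b * b) * (inv a * inv a)        ≈⟨ *-congʳ (trans bb≈cx (*-congˡ (sym aa≈x))) ⟩
      (c * (a * a)) * (inv a * inv a)  ≈⟨ *-assoc c _ _ ⟩
      c * ((a * a) * (inv a * inv a))  ≈⟨ *-congˡ (interchange a a (inv a) (inv a)) ⟩
      c * ((a * inv a) * (a * inv a))  ≈⟨ *-congˡ (*-cong (x*inv[x]≈1 a≉0) (x*inv[x]≈1 a≉0)) ⟩
      c * (1# * 1#)                    ≈⟨ *-congˡ (*-identityˡ 1#) ⟩
      c * 1#                           ≈⟨ *-identityʳ c ⟩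
      c                                ∎))
      where
      open ≈-Reasoning
      a≉0 : ¬ a ≈ 0#
      a≉0 a≈0 = x≉0 (trans (sym aa≈x) (x≈0⇒x*y≈0 a a≈0))

    rootCount-pair : Carrier → ℕ
    rootCount-pair x = rootCount x ℕ.+ rootCount (c * x)

    rootCount-pair≤2 : ∀ x → rootCount-pair x ≤ 2
    rootCount-pair≤2 x with x ≟ 0#
    ... | yes x≈0 =
      ℕₚ.≤-reflexive (≡.cong₂ ℕ._+_ (rootCount-zero x≈0) (rootCount-zero (trans (*-congˡ x≈0) (zeroʳ c))))
    ... | no x≉0 with isSquare? x
    ...   | yes □x = begin
      rootCount x ℕ.+ rootCount (c * x)  ≡⟨ ≡.cong (rootCount x ℕ.+_) (rootCount-nonsquare (c*x-nonsquare □x x≉0)) ⟩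
      rootCount x ℕ.+ 0                  ≡⟨ ℕₚ.+-identityʳ (rootCount x) ⟩
      rootCount x                        ≤⟨ rootCount≤2 1+1≉0 x ⟩
      2                                  ∎
      where open ℕₚ.≤-Reasoning
    ...   | no ¬□x = begin
      rootCount x ℕ.+ rootCount (c * x)  ≡⟨ ≡.cong (ℕ._+ rootCount (c * x)) (rootCount-nonsquare ¬□x) ⟩
      rootCount (c * x)                  ≤⟨ rootCount≤2 1+1≉0 (c * x) ⟩
      2                                  ∎
      where open ℕₚ.≤-Reasoning

    -- Both sides sum to 2N, so the pointwise bound rootCount-pair≤2 is an equality.
    rootCount-pair≡2 : ∀ x → rootCount-pair x ≡ 2
    rootCount-pair≡2 = ∑-≤-≡ (λ x≈y → ≡.cong₂ ℕ._+_ (rootCount-cong x≈y) (rootCount-cong (*-congˡ x≈y)))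
                             (λ _ → ≡.refl) rootCount-pair≤2 (begin
      ∑ rootCount-pair                              ≡⟨ ∑-+ rootCount (rootCount ∘ (c *_)) ⟩
      ∑ rootCount ℕ.+ ∑ (λ x → rootCount (c * x))   ≡⟨ ≡.cong (∑ rootCount ℕ.+_) (∑-scale c≉0 rootCount-cong) ⟩
      ∑ rootCount ℕ.+ ∑ rootCount                   ≡⟨ ≡.cong₂ ℕ._+_ ∑-rootCount ∑-rootCount ⟩
      N ℕ.+ N                                       ≡⟨ ≡.cong₂ ℕ._+_ ∑-1 ∑-1 ⟨
      ∑ (λ _ → 1) ℕ.+ ∑ (λ _ → 1)                   ≡⟨ ∑-+ (λ _ → 1) (λ _ → 1) ⟨
      ∑ (λ _ → 2)                                   ∎)
      where open ≡.≡-Reasoning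

    #[y*y∈V]≡#V : ∀ {v} {V : Pred Carrier v} (V? : Decidable V) → V Respects _≈_ →
                  (∀ {x} → V x → V (c * x)) → (∀ {x} → V (c * x) → V x) → # (λ y → V? (y * y)) ≡ # V?
    #[y*y∈V]≡#V V? V-resp c·V⊆V c⁻¹·V⊆V = ≡.trans (∑-fibres (λ y → y * y) χ-cong) (ℕₚ.*-cancelʳ-≡ R (# V?) 2 (begin
      R ℕ.* 2                                            ≡⟨ ℕₚ.*-comm R 2 ⟩
      R ℕ.+ (R ℕ.+ 0)                                    ≡⟨ ≡.cong (R ℕ.+_) (ℕₚ.+-identityʳ R) ⟩
      R ℕ.+ R                                            ≡⟨ ≡.cong (R ℕ.+_) R≡R[c*] ⟩
      R ℕ.+ ∑ (λ x → χ x ℕ.* rootCount (c * x))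
        ≡⟨ ∑-+ (λ x → χ x ℕ.* rootCount x) (λ x → χ x ℕ.* rootCount (c * x)) ⟨
      ∑ (λ x → χ x ℕ.* rootCount x ℕ.+ χ x ℕ.* rootCount (c * x))
        ≡⟨ ∑-cong (λ x → ℕₚ.*-distribˡ-+ (χ x) (rootCount x) (rootCount (c * x))) ⟨
      ∑ (λ x → χ x ℕ.* rootCount-pair x)                 ≡⟨ ∑-cong (λ x → ≡.cong (χ x ℕ.*_) (rootCount-pair≡2 x)) ⟩
      ∑ (λ x → χ x ℕ.* 2)                                ≡⟨ ∑-*ʳ 2 χ ⟩
      # V? ℕ.* 2                                         ∎))
      where
      open ≡.≡-Reasoning
      χ : Carrier → ℕ
      χ = 𝟙 ∘ V?

      χ-cong : χ Preserves _≈_ ⟶ _≡_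
      χ-cong = 𝟙∘-cong V? V-resp

      g : Carrier → ℕ
      g x = χ x ℕ.* rootCount x

      g-cong : g Preserves _≈_ ⟶ _≡_
      g-cong x≈y = ≡.cong₂ ℕ._*_ (χ-cong x≈y) (rootCount-cong x≈y)

      R : ℕ
      R = ∑ g

      R≡R[c*] : R ≡ ∑ (λ x → χ x ℕ.* rootCount (c * x))
      R≡R[c*] = begin
        R                                          ≡⟨ ∑-scale c≉0 g-cong ⟨
        ∑ (λ x → χ (c * x) ℕ.* rootCount (c * x))  ≡⟨ ∑-cong (λ x → ≡.cong (ℕ._* rootCount (c * x)) (χ[c*x]≡χ[x] x)) ⟩
        ∑ (λ x → χ x ℕ.* rootCount (c * x))        ∎
        where
        χ[c*x]≡χ[x] : ∀ x → χ (c * x) ≡ χ x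
        χ[c*x]≡χ[x] x = 𝟙-cong c⁻¹·V⊆V c·V⊆V (V? (c * x)) (V? x)

  #[y*y∈V]≡#V-subspace : ¬ 1# + 1# ≈ 0# → ∀ {p v q n} (F : Subfield K p) → # (Subfield.dec F) ≡ q → 1 < q →
                         ¬ 2 ∣ q → N ≡ q ^ n → ¬ 2 ∣ n → (V : Subspace K F v) →
                         # (λ y → Subspace.dec V (y * y)) ≡ # (Subspace.dec V)
  #[y*y∈V]≡#V-subspace 1+1≉0 F #F≡q 1<q q-odd N≡qⁿ n-odd V
    with subfield-nonsquare F 1+1≉0 #F≡q 1<q q-odd N≡qⁿ n-odd
  ... | c , c∈F , c-nonsquare = #[y*y∈V]≡#V 1+1≉0 c-nonsquare V.dec V.resp (V.smul-mem c∈F) c⁻¹·V⊆V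
    where
    module F = Subfield F
    module V = Subspace V

    c≉0 : ¬ c ≈ 0#
    c≉0 = nonsquare⇒≉0 c-nonsquare

    c⁻¹·V⊆V : ∀ {x} → V.mem (c * x) → V.mem x
    c⁻¹·V⊆V {x} cx∈V = V.resp (inv[x]*[x*y]≈y c≉0 x) (V.smul-mem (F.inv-mem c∈F (x*inv[x]≈1 c≉0)) cx∈V)

lemma2p1 : {c ℓ p r : Level} (K : CommutativeRing c ℓ) → IsField K
    → (q n : ℕ) → IsPrimePower q → ¬ (2 ∣ q) → 2 ≤ n → ¬ (2 ∣ n)
    → (E : Enumeration K (q ^ n))
    → (F : Subfield K p) → count K E (Subfield.dec F) ≡ q
    → (V : Subspace K F r)
    → count K E (λ y → Subspace.dec V (CommutativeRing._*_ K y y)) ≡ count K E (Subspace.dec V)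
lemma2p1 K isField q n q-primePower q-odd _ n-odd E F countF≡q V = begin
  count K E (λ y → V.dec (y * y))  ≡⟨ count≡# (λ y → V.dec (y * y)) ⟩
  # (λ y → V.dec (y * y))          ≡⟨ #[y*y∈V]≡#V-subspace 1+1≉0 F #F≡q 1<q q-odd ≡.refl n-odd V ⟩
  # V.dec                          ≡⟨ count≡# V.dec ⟨
  count K E V.dec                  ∎
  where
  open CommutativeRing K using (_*_; _≈_; 1#; 0#; _+_)
  open Counting K E using (#; count≡#)
  open FiniteField K isField E using (1+1≈0⇒2∣N; #[y*y∈V]≡#V-subspace)
  open ≡.≡-Reasoning
  module V = Subspace V

  1+1≉0 : ¬ 1# + 1# ≈ 0#
  1+1≉0 = odd^n n q-odd ∘ 1+1≈0⇒2∣N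

  1<q : 1 < q
  1<q = primePower>1 q-primePower

  #F≡q : # (Subfield.dec F) ≡ q
  #F≡q = ≡.trans (≡.sym (count≡# (Subfield.dec F))) countF≡q
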